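{- For each integer $n\ge 0$ let $\rho_{od}(n)$ denote the number of partitions of $n$ in which the largest part $\ell$ appears exactly once, the remaining parts are odd and pairwise distinct, and the remaining parts (all strictly smaller than $\ell$) form a partition of $\ell$ (the largest part $\ell$ itself may be even or odd). Then $$\sum_{n=0}^{\infty}\rho_{od}(n)q^n=(-q^2;q^4)_{\infty}-\frac{q^2}{1-q^4}-1.$$
   Context: A partition of a positive integer $n$ is a way of writing $n$ as a sum of positive integers (parts), listed in non-increasing order; the empty partition has no largest part and is not counted. For $|q|<1$, $(t;q)_0=1$, $(t;q)_n=(1-t)(1-tq)\cdots(1-tq^{n-1})$ for $n>0$, and $(t;q)_\infty=\lim_{n\to\infty}(t;q)_n$. -}

module Defs where

open import Data.Nat as ℕ using (ℕ; zero; suc; _≥_; _≟_; _≥?_; _≤?_)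
open import Data.Nat.Divisibility using (_∣_; _∣?_)
open import Data.Integer as ℤ using (ℤ; +_)
open import Data.List using (List; []; _∷_; length; filter; map; concatMap; upTo)
open import Data.Nat.ListAction using (sum)
open import Data.List.Relation.Unary.All using (All; all?)
open import Data.List.Relation.Unary.Linked using (Linked; linked?)
open import Data.List.Relation.Unary.Unique.Propositional using (Unique)
open import Data.List.Relation.Unary.AllPairs using (allPairs?)
open import Data.Product using (_×_)
open import Data.Empty using (⊥)
open import Relation.Nullary using (¬_; Dec; yes; no)
open import Relation.Nullary.Decidable using (_×-dec_; ¬?)
open import Relation.Binary.PropositionalEquality using (_≡_; _≢_)

IsPartition : ℕ → List ℕ → Set
IsPartition n ps = All (λ p → 1 ℕ.≤ p) ps × Linked _≥_ ps × sum ps ≡ n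

Odd : ℕ → Set
Odd m = ¬ (2 ∣ m)

count : ℕ → List ℕ → ℕ
count x xs = length (filter (x ≟_) xs)

ODCond : List ℕ → Set
ODCond []         = ⊥
ODCond (ℓ ∷ rest) =
  count ℓ (ℓ ∷ rest) ≡ 1 × All Odd rest × Unique rest × sum rest ≡ ℓ

IsPartition? : ∀ n ps → Dec (IsPartition n ps)
IsPartition? n ps = all? (λ p → 1 ≤? p) ps ×-dec linked? _≥?_ ps ×-dec (sum ps ≟ n)

ODCond? : ∀ ps → Dec (ODCond ps)
ODCond? []         = no (λ ())
ODCond? (ℓ ∷ rest) =
  (count ℓ (ℓ ∷ rest) ≟ 1) ×-dec all? (λ m → ¬? (2 ∣? m)) rest
    ×-dec allPairs? (λ a b → ¬? (a ≟ b)) rest ×-dec (sum rest ≟ ℓ)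

listsOf : ℕ → List ℕ → List (List ℕ)
listsOf zero    xs = [] ∷ []
listsOf (suc k) xs = concatMap (λ x → map (x ∷_) (listsOf k xs)) xs

-- All lists of length ≤ n with entries in {0,…,n}; every partition of n
-- occurs exactly once among them.
candidates : ℕ → List (List ℕ)
candidates n = concatMap (λ k → listsOf k (upTo (suc n))) (upTo (suc n))

ρod : ℕ → ℕ
ρod n = length (filter (λ ps → IsPartition? n ps ×-dec ODCond? ps) (candidates n))

FPS : Set
FPS = ℕ → ℤ

Σ< : ℕ → (ℕ → ℤ) → ℤ
Σ< zero    f = + 0
Σ< (suc k) f = Σ< k f ℤ.+ f k

infixl 6 _⊕_ _⊖_
infixl 7 _⊛_

_⊕_ : FPS → FPS → FPS
(f ⊕ g) n = f n ℤ.+ g n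

_⊖_ : FPS → FPS → FPS
(f ⊖ g) n = f n ℤ.- g n

neg : FPS → FPS
neg f n = ℤ.- f n

_⊛_ : FPS → FPS → FPS
(f ⊛ g) n = Σ< (suc n) (λ i → f i ℤ.* g (n ℕ.∸ i))

one : FPS
one zero    = + 1
one (suc n) = + 0

qˆ : ℕ → FPS
qˆ k n with k ≟ n
... | yes _ = + 1
... | no  _ = + 0

pow : FPS → ℕ → FPS
pow f zero    = one
pow f (suc j) = f ⊛ pow f j

Π< : ℕ → (ℕ → FPS) → FPS
Π< zero    F = one
Π< (suc m) F = Π< m F ⊛ F m

ΣS< : ℕ → (ℕ → FPS) → FPS
ΣS< zero    F n = + 0
ΣS< (suc m) F n = ΣS< m F n ℤ.+ F m n

-- q-Pochhammer (t;s)_∞ = Π_{k≥0} (1 - t s^k), for t, s with zero constant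
-- term (then the k-th factor is 1 + O(q^{k+1}), so the coefficient of q^n
-- is determined by the factors k ≤ n: the usual q-adic limit).
pochInf : FPS → FPS → FPS
pochInf t s n = Π< (suc n) (λ k → one ⊖ t ⊛ pow s k) n

-- 1/(1 - x) = Σ_{j≥0} x^j, for x with zero constant term (coefficient of
-- q^n is determined by j ≤ n).
inv1m : FPS → FPS
inv1m x n = ΣS< (suc n) (pow x) n

-- A partition counted by ρ_od(n) is a largest part ℓ followed by a partition
-- of ℓ into distinct odd parts smaller than ℓ.  Hence ρ_od(n) = 0 unless n = 2ℓ,
-- and ρ_od(2ℓ) counts the partitions of ℓ into distinct odd parts except the
-- one-part partition ℓ, which exists iff ℓ is odd.  On the other side,
-- (-q²;q⁴)_∞ = ∏_k (1 + q^{2(2k+1)}), whose coefficient of q^{2ℓ} is the number of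
-- partitions of ℓ into distinct odd parts; q²/(1-q⁴) = Σ_{ℓ odd} q^{2ℓ} removes the
-- one-part partitions and the final 1 the empty partition of 0.

module Submission where

open import Defs
open import Data.Nat using (ℕ)
open import Data.Integer using (+_)
open import Relation.Binary.PropositionalEquality using (_≡_)

open import Algebra.Properties.CommutativeSemigroup using (interchange)
open import Data.Nat
  using (zero; suc; _+_; _*_; _∸_; _≤_; _<_; _>_; z≤n; s≤s; NonZero; _≟_; _≤?_; _<?_; _>?_)
open import Data.Nat.Properties
open import Data.Nat.Divisibility
  using ( _∣_; _∣?_; divides; quotient; m∣n⇒n≡m*quotient; m∣m*n; ∣-trans
        ; *-cancelˡ-∣; *-monoʳ-∣)
open import Data.Nat.ListAction using (sum)
open import Data.Nat.Tactic.RingSolver as ℕ-Solver using ()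
open import Data.Integer as ℤ using (-_)
import Data.Integer.Properties as ℤ
open import Data.Integer.Tactic.RingSolver as ℤ-Solver using ()
open import Data.List
  using (List; []; _∷_; [_]; _++_; length; filter; map; concatMap; applyUpTo; upTo)
open import Data.List.Properties
  using (length-++; filter-++; filter-≐; filter-accept; filter-none; filter-some)
open import Data.List.Relation.Unary.All as All using (All; []; _∷_; all?)
open import Data.List.Relation.Unary.All.Properties using (¬Any⇒All¬)
open import Data.List.Relation.Unary.AllPairs as AllPairs using (_∷_)
open import Data.List.Relation.Unary.Linked as Linked using (Linked; [-]; _∷_; linked?)
open import Data.List.Relation.Unary.Linked.Properties using (AllPairs⇒Linked; Linked⇒AllPairs)
open import Data.Product using (_×_; _,_; proj₁; proj₂)
open import Data.Sum using (inj₁; inj₂)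
open import Function using (_∘_; id)
open import Function.Bundles using (_⇔_; mk⇔; module Equivalence)
import Function.Properties.Equivalence as ⇔
open import Relation.Nullary using (¬_; Dec; yes; no; contradiction)
open import Relation.Nullary.Decidable using (_×-dec_; ¬?)
open import Relation.Unary using (Decidable; _≐_)
open import Relation.Binary.PropositionalEquality
  using (refl; sym; trans; cong; cong₂; subst; _≢_; module ≡-Reasoning)

open ≡-Reasoning
open Equivalence using (to; from)

data Parity : ℕ → Set where
  even : ∀ s → Parity (2 * s)
  odd  : ∀ s → Parity (suc (2 * s))

parity : ∀ n → Parity n
parity zero = even 0
parity (suc n) with parity n
... | even s = odd s
... | odd s  = subst Parity (*-suc 2 s) (even (suc s))

odd? : ∀ m → Dec (Odd m)
odd? m = ¬? (2 ∣? m)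

¬odd-double : ∀ s → ¬ Odd (2 * s)
¬odd-double s o = o (m∣m*n s)

odd-suc-double : ∀ s → Odd (suc (2 * s))
odd-suc-double s (divides q eq) = even≢odd q s (sym (trans eq (*-comm q 2)))

odd⇒positive : ∀ {m} → Odd m → 1 ≤ m
odd⇒positive {zero}  o = contradiction (m∣m*n 0) o
odd⇒positive {suc m} o = s≤s z≤n

even⇔odd-suc : ∀ t → 2 ∣ t ⇔ Odd (suc t)
even⇔odd-suc t with parity t
... | even u = mk⇔ (λ _ → odd-suc-double u) (λ _ → m∣m*n u)
... | odd u  = mk⇔ (λ 2∣t → contradiction 2∣t (odd-suc-double u))
                   (contradiction (subst (2 ∣_) (*-suc 2 u) (m∣m*n (suc u))))

when : {P : Set} → Dec P → ℕ → ℕ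
when (yes _) a = a
when (no _)  _ = 0

when-yes : ∀ {P} (p? : Dec P) {a} → P → when p? a ≡ a
when-yes (yes _) _ = refl
when-yes (no ¬p) p = contradiction p ¬p

when-no : ∀ {P} (p? : Dec P) {a} → ¬ P → when p? a ≡ 0
when-no (yes p) ¬p = contradiction p ¬p
when-no (no _)  _  = refl

when-⇔ : ∀ {P Q} (p? : Dec P) (q? : Dec Q) {a} → P ⇔ Q → when p? a ≡ when q? a
when-⇔ (yes _) (yes _) _   = refl
when-⇔ (no _)  (no _)  _   = refl
when-⇔ (yes p) (no ¬q) P⇔Q = contradiction (to P⇔Q p) ¬q
when-⇔ (no ¬p) (yes q) P⇔Q = contradiction (from P⇔Q q) ¬p

Σ<ℕ : ℕ → (ℕ → ℕ) → ℕ
Σ<ℕ zero    f = 0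
Σ<ℕ (suc n) f = f 0 + Σ<ℕ n (f ∘ suc)

Σ<ℕ-cong : ∀ n {f g} → (∀ i → i < n → f i ≡ g i) → Σ<ℕ n f ≡ Σ<ℕ n g
Σ<ℕ-cong zero    f≗g = refl
Σ<ℕ-cong (suc n) f≗g =
  cong₂ _+_ (f≗g 0 (s≤s z≤n)) (Σ<ℕ-cong n (λ i i<n → f≗g (suc i) (s≤s i<n)))

Σ<ℕ-zero : ∀ n {f} → (∀ i → i < n → f i ≡ 0) → Σ<ℕ n f ≡ 0
Σ<ℕ-zero zero    f≗0 = refl
Σ<ℕ-zero (suc n) f≗0 =
  cong₂ _+_ (f≗0 0 (s≤s z≤n)) (Σ<ℕ-zero n (λ i i<n → f≗0 (suc i) (s≤s i<n)))

Σ<ℕ-snoc : ∀ n f → Σ<ℕ (suc n) f ≡ Σ<ℕ n f + f n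
Σ<ℕ-snoc zero    f = +-comm (f 0) 0
Σ<ℕ-snoc (suc n) f = trans (cong (_+_ (f 0)) (Σ<ℕ-snoc n (f ∘ suc))) (sym (+-assoc (f 0) _ _))

Σ<ℕ-delta : ∀ n {f} p → p < n → (∀ i → i < n → i ≢ p → f i ≡ 0) →
  Σ<ℕ n f ≡ f p
Σ<ℕ-delta (suc n) {f} zero _ off =
  trans (cong (_+_ (f 0)) (Σ<ℕ-zero n (λ i i<n → off (suc i) (s≤s i<n) λ ())))
        (+-identityʳ (f 0))
Σ<ℕ-delta (suc n) (suc p) (s≤s p<n) off =
  cong₂ _+_ (off 0 (s≤s z≤n) λ ())
            (Σ<ℕ-delta n p p<n (λ i i<n i≢p → off (suc i) (s≤s i<n) (i≢p ∘ suc-injective)))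

Σ<ℕ-distrib-+ : ∀ n f g → Σ<ℕ n (λ i → f i + g i) ≡ Σ<ℕ n f + Σ<ℕ n g
Σ<ℕ-distrib-+ zero    f g = refl
Σ<ℕ-distrib-+ (suc n) f g =
  trans (cong (_+_ (f 0 + g 0)) (Σ<ℕ-distrib-+ n (f ∘ suc) (g ∘ suc)))
        (interchange +-commutativeSemigroup (f 0) (g 0) _ _)

Σ<ℕ-comm : ∀ m n (h : ℕ → ℕ → ℕ) →
  Σ<ℕ m (λ j → Σ<ℕ n (h j)) ≡ Σ<ℕ n (λ i → Σ<ℕ m (λ j → h j i))
Σ<ℕ-comm zero    n h = sym (Σ<ℕ-zero n {λ _ → 0} (λ _ _ → refl))
Σ<ℕ-comm (suc m) n h =
  trans (cong (_+_ (Σ<ℕ n (h 0))) (Σ<ℕ-comm m n (h ∘ suc)))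
        (sym (Σ<ℕ-distrib-+ n (h 0) (λ i → Σ<ℕ m (λ j → h (suc j) i))))

Σ<ℕ-when : ∀ n {P} (p? : Dec P) f → Σ<ℕ n (λ i → when p? (f i)) ≡ when p? (Σ<ℕ n f)
Σ<ℕ-when n (yes _) f = refl
Σ<ℕ-when n (no _)  f = Σ<ℕ-zero n (λ _ _ → refl)

Σ<ℕ-truncate : ∀ {m n} f → m ≤ n → (∀ i → m ≤ i → i < n → f i ≡ 0) →
  Σ<ℕ n f ≡ Σ<ℕ m f
Σ<ℕ-truncate {zero}  {n}     f _         tail≗0 = Σ<ℕ-zero n (λ i → tail≗0 i z≤n)
Σ<ℕ-truncate {suc m} {suc n} f (s≤s m≤n) tail≗0 =
  cong (_+_ (f 0))
       (Σ<ℕ-truncate (f ∘ suc) m≤n (λ i m≤i i<n → tail≗0 (suc i) (s≤s m≤i) (s≤s i<n)))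

countWhere : {A : Set} {P : A → Set} → Decidable P → List A → ℕ
countWhere P? xs = length (filter P? xs)

module _ {A : Set} {P : A → Set} (P? : Decidable P) where

  countWhere-++ : ∀ xs ys → countWhere P? (xs ++ ys) ≡ countWhere P? xs + countWhere P? ys
  countWhere-++ xs ys = trans (cong length (filter-++ P? xs ys)) (length-++ (filter P? xs))

  countWhere-[-] : ∀ x → countWhere P? [ x ] ≡ when (P? x) 1
  countWhere-[-] x with P? x
  ... | yes _ = refl
  ... | no  _ = refl

  countWhere-≐ : ∀ {Q : A → Set} (Q? : Decidable Q) → P ≐ Q →
    ∀ xs → countWhere P? xs ≡ countWhere Q? xs
  countWhere-≐ Q? P≐Q xs = cong length (filter-≐ P? Q? P≐Q xs)

  countWhere-const× : ∀ {B} (b? : Dec B) xs →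
    countWhere (λ x → b? ×-dec P? x) xs ≡ when b? (countWhere P? xs)
  countWhere-const× (yes b) xs =
    cong length (filter-≐ (λ x → yes b ×-dec P? x) P? (proj₂ , (b ,_)) xs)
  countWhere-const× (no _)  []       = refl
  countWhere-const× (no ¬b) (x ∷ xs) = countWhere-const× (no ¬b) xs

  countWhere-concatMap : ∀ (h : ℕ → List A) f n →
    countWhere P? (concatMap h (applyUpTo f n)) ≡ Σ<ℕ n (λ i → countWhere P? (h (f i)))
  countWhere-concatMap h f zero    = refl
  countWhere-concatMap h f (suc n) =
    trans (countWhere-++ (h (f 0)) _)
          (cong (_+_ (countWhere P? (h (f 0)))) (countWhere-concatMap h (f ∘ suc) n))

countWhere-map-∷ : ∀ {A : Set} {P : List A → Set} (P? : Decidable P) x rs →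
  countWhere P? (map (x ∷_) rs) ≡ countWhere (P? ∘ (x ∷_)) rs
countWhere-map-∷ P? x []       = refl
countWhere-map-∷ P? x (r ∷ rs) with P? (x ∷ r)
... | yes _ = cong suc (countWhere-map-∷ P? x rs)
... | no  _ = countWhere-map-∷ P? x rs

countWhere-listsOf : ∀ {P : List ℕ → Set} (P? : Decidable P) j M →
  countWhere P? (listsOf (suc j) (upTo M)) ≡
  Σ<ℕ M (λ x → countWhere (P? ∘ (x ∷_)) (listsOf j (upTo M)))
countWhere-listsOf P? j M =
  trans (countWhere-concatMap P? (λ x → map (x ∷_) (listsOf j (upTo M))) id M)
        (Σ<ℕ-cong M (λ x _ → countWhere-map-∷ P? x (listsOf j (upTo M))))

-- Partitions into distinct odd parts

OddPart : ℕ → ℕ → Set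
OddPart s x = Odd x × x ≤ s

oddPart? : ∀ s x → Dec (OddPart s x)
oddPart? s x = odd? x ×-dec x ≤? s

-- The number of partitions of s into distinct odd parts smaller than b,
-- split according to whether b - 1 is a part.
distinctOdd : ℕ → ℕ → ℕ
distinctOdd zero    s = when (s ≟ 0) 1
distinctOdd (suc b) s = distinctOdd b s + when (oddPart? s b) (distinctOdd b (s ∸ b))

distinctOdd-unfold : ∀ b s →
  distinctOdd b s ≡
  when (s ≟ 0) 1 + Σ<ℕ b (λ x → when (oddPart? s x) (distinctOdd x (s ∸ x)))
distinctOdd-unfold zero    s = sym (+-identityʳ _)
distinctOdd-unfold (suc b) s = begin
    distinctOdd b s + g b
  ≡⟨ cong (_+ g b) (distinctOdd-unfold b s) ⟩
    when (s ≟ 0) 1 + Σ<ℕ b g + g b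
  ≡⟨ +-assoc (when (s ≟ 0) 1) _ _ ⟩
    when (s ≟ 0) 1 + (Σ<ℕ b g + g b)
  ≡⟨ cong (_+_ (when (s ≟ 0) 1)) (sym (Σ<ℕ-snoc b g)) ⟩
    when (s ≟ 0) 1 + Σ<ℕ (suc b) g
  ∎
  where
  g : ℕ → ℕ
  g x = when (oddPart? s x) (distinctOdd x (s ∸ x))

distinctOdd-zero : ∀ b → distinctOdd b 0 ≡ 1
distinctOdd-zero zero    = refl
distinctOdd-zero (suc b) =
  cong₂ _+_ (distinctOdd-zero b)
            (when-no (oddPart? 0 b) (λ (o , b≤0) → ¬odd-double 0 (subst Odd (n≤0⇒n≡0 b≤0) o)))

distinctOdd-skipEven : ∀ a s → distinctOdd (suc (2 * a)) s ≡ distinctOdd (2 * a) s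
distinctOdd-skipEven a s =
  trans (cong (_+_ (distinctOdd (2 * a) s)) (when-no (oddPart? s (2 * a)) (¬odd-double a ∘ proj₁)))
        (+-identityʳ _)

distinctOdd-double-suc : ∀ m s → let k = suc (2 * m) in
  distinctOdd (2 * suc m) s ≡ distinctOdd (2 * m) s + when (k ≤? s) (distinctOdd (2 * m) (s ∸ k))
distinctOdd-double-suc m s = begin
    distinctOdd (2 * suc m) s
  ≡⟨ cong (λ b → distinctOdd b s) (*-suc 2 m) ⟩
    distinctOdd k s + when (oddPart? s k) (distinctOdd k (s ∸ k))
  ≡⟨ cong₂ (λ x y → x + when (oddPart? s k) y)
           (distinctOdd-skipEven m s) (distinctOdd-skipEven m (s ∸ k)) ⟩
    distinctOdd (2 * m) s + when (oddPart? s k) (distinctOdd (2 * m) (s ∸ k))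
  ≡⟨ cong (_+_ (distinctOdd (2 * m) s))
          (when-⇔ (oddPart? s k) (k ≤? s) (mk⇔ proj₂ (odd-suc-double m ,_))) ⟩
    distinctOdd (2 * m) s + when (k ≤? s) (distinctOdd (2 * m) (s ∸ k))
  ∎
  where
  k = suc (2 * m)

distinctOdd-stable : ∀ {b s} → s < b → distinctOdd b s ≡ distinctOdd (suc s) s
distinctOdd-stable {suc b} {s} s<1+b with m<1+n⇒m<n∨m≡n s<1+b
... | inj₂ refl = refl
... | inj₁ s<b  =
  trans (cong (_+_ (distinctOdd b s)) (when-no (oddPart? s b) (<⇒≱ s<b ∘ proj₂)))
        (trans (+-identityʳ _) (distinctOdd-stable s<b))

-- b heads the chain, so that Linked _>_ also bounds every part by b.
DistinctOddBelow : ℕ → ℕ → List ℕ → Set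
DistinctOddBelow b s r = Linked _>_ (b ∷ r) × All Odd r × sum r ≡ s

distinctOddBelow? : ∀ b s → Decidable (DistinctOddBelow b s)
distinctOddBelow? b s r = linked? _>?_ (b ∷ r) ×-dec all? odd? r ×-dec (sum r ≟ s)

DistinctOddBelow-∷⁻ : ∀ {b s x r} →
  DistinctOddBelow b s (x ∷ r) → (x < b × OddPart s x) × DistinctOddBelow x (s ∸ x) r
DistinctOddBelow-∷⁻ {s = s} {x} {r} (x<b ∷ chain , o ∷ odds , x+Σr≡s) =
  (x<b , o , subst (x ≤_) x+Σr≡s (m≤m+n x (sum r))) ,
  chain , odds , trans (sym (m+n∸m≡n x (sum r))) (cong (_∸ x) x+Σr≡s)

DistinctOddBelow-∷⁺ : ∀ {b s x r} →
  (x < b × OddPart s x) × DistinctOddBelow x (s ∸ x) r → DistinctOddBelow b s (x ∷ r)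
DistinctOddBelow-∷⁺ {x = x} ((x<b , o , x≤s) , chain , odds , Σr≡s∸x) =
  x<b ∷ chain , o ∷ odds , trans (cong (_+_ x) Σr≡s∸x) (m+[n∸m]≡n x≤s)

countWhere-distinctOddBelow-suc : ∀ {M} j b s → b ≤ M →
  countWhere (distinctOddBelow? b s) (listsOf (suc j) (upTo M)) ≡
  Σ<ℕ b (λ x → when (oddPart? s x)
                    (countWhere (distinctOddBelow? x (s ∸ x)) (listsOf j (upTo M))))
countWhere-distinctOddBelow-suc {M} j b s b≤M = begin
    countWhere (distinctOddBelow? b s) (listsOf (suc j) (upTo M))
  ≡⟨ countWhere-listsOf (distinctOddBelow? b s) j M ⟩
    Σ<ℕ M (λ x → countWhere (distinctOddBelow? b s ∘ (x ∷_)) (listsOf j (upTo M)))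
  ≡⟨ Σ<ℕ-cong M (λ x _ → splitHead x) ⟩
    Σ<ℕ M (λ x → when (head? x) (tails x))
  ≡⟨ Σ<ℕ-truncate _ b≤M (λ x b≤x _ → when-no (head? x) (λ (x<b , _) → <⇒≱ x<b b≤x)) ⟩
    Σ<ℕ b (λ x → when (head? x) (tails x))
  ≡⟨ Σ<ℕ-cong b (λ x x<b → when-⇔ (head? x) (oddPart? s x) (mk⇔ proj₂ (x<b ,_))) ⟩
    Σ<ℕ b (λ x → when (oddPart? s x) (tails x))
  ∎
  where
  head? : ∀ x → Dec (x < b × OddPart s x)
  head? x = x <? b ×-dec oddPart? s x
  tails : ℕ → ℕ
  tails x = countWhere (distinctOddBelow? x (s ∸ x)) (listsOf j (upTo M))
  splitHead : ∀ x →
    countWhere (distinctOddBelow? b s ∘ (x ∷_)) (listsOf j (upTo M)) ≡ when (head? x) (tails x)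
  splitHead x =
    trans (countWhere-≐ (distinctOddBelow? b s ∘ (x ∷_))
                        (λ r → head? x ×-dec distinctOddBelow? x (s ∸ x) r)
                        (DistinctOddBelow-∷⁻ , DistinctOddBelow-∷⁺) (listsOf j (upTo M)))
          (countWhere-const× (distinctOddBelow? x (s ∸ x)) (head? x) (listsOf j (upTo M)))

-- A list counted by distinctOdd b s has entries below b and, its parts being
-- positive, length at most s.
Σ-countWhere-distinctOddBelow : ∀ {M} J b s → b ≤ M → s < J →
  Σ<ℕ J (λ j → countWhere (distinctOddBelow? b s) (listsOf j (upTo M))) ≡ distinctOdd b s
Σ-countWhere-distinctOddBelow {M} (suc J) b s b≤M (s≤s s≤J) = begin
    countWhere (distinctOddBelow? b s) [ [] ] + Σ<ℕ J (λ j → counted (suc j) b s)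
  ≡⟨ cong₂ _+_ empty (Σ<ℕ-cong J (λ j _ → countWhere-distinctOddBelow-suc j b s b≤M)) ⟩
    when (s ≟ 0) 1 + Σ<ℕ J (λ j → Σ<ℕ b (λ x → withPart x (counted j x (s ∸ x))))
  ≡⟨ cong (_+_ (when (s ≟ 0) 1)) (Σ<ℕ-comm J b (λ j x → withPart x (counted j x (s ∸ x)))) ⟩
    when (s ≟ 0) 1 + Σ<ℕ b (λ x → Σ<ℕ J (λ j → withPart x (counted j x (s ∸ x))))
  ≡⟨ cong (_+_ (when (s ≟ 0) 1)) (Σ<ℕ-cong b (λ x x<b →
       trans (Σ<ℕ-when J (oddPart? s x) (λ j → counted j x (s ∸ x))) (byPart x x<b))) ⟩
    when (s ≟ 0) 1 + Σ<ℕ b (λ x → when (oddPart? s x) (distinctOdd x (s ∸ x)))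
  ≡⟨ sym (distinctOdd-unfold b s) ⟩
    distinctOdd b s
  ∎
  where
  counted : ℕ → ℕ → ℕ → ℕ
  counted j c t = countWhere (distinctOddBelow? c t) (listsOf j (upTo M))
  withPart : ℕ → ℕ → ℕ
  withPart x = when (oddPart? s x)
  empty : countWhere (distinctOddBelow? b s) [ [] ] ≡ when (s ≟ 0) 1
  empty = trans (countWhere-[-] (distinctOddBelow? b s) [])
                (when-⇔ _ (s ≟ 0) (mk⇔ (sym ∘ proj₂ ∘ proj₂) (λ s≡0 → [-] , [] , sym s≡0)))
  byPart : ∀ x → x < b →
    withPart x (Σ<ℕ J (λ j → counted j x (s ∸ x))) ≡ withPart x (distinctOdd x (s ∸ x))
  byPart x x<b with oddPart? s x
  ... | no  _         = refl
  ... | yes (o , x≤s) =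
    Σ-countWhere-distinctOddBelow J x (s ∸ x) (≤-trans (<⇒≤ x<b) b≤M)
      (<-≤-trans (∸-monoʳ-< (odd⇒positive o) x≤s) s≤J)

-- ρ_od through distinctOdd

HalfOf : ℕ → ℕ → Set
HalfOf n ℓ = 1 ≤ ℓ × 2 * ℓ ≡ n

halfOf? : ∀ n ℓ → Dec (HalfOf n ℓ)
halfOf? n ℓ = 1 ≤? ℓ ×-dec (2 * ℓ ≟ n)

halfOf⇒< : ∀ {n ℓ} → HalfOf n ℓ → ℓ < n
halfOf⇒< {ℓ = ℓ} (1≤ℓ , 2ℓ≡n) =
  subst (ℓ <_) 2ℓ≡n (m<m+n ℓ (≤-trans 1≤ℓ (m≤m+n ℓ 0)))

count-head : ∀ x r → count x (x ∷ r) ≡ suc (count x r)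
count-head x r = cong length (filter-accept (x ≟_) refl)

ρodShape⁻ : ∀ {n ℓ r} →
  IsPartition n (ℓ ∷ r) × ODCond (ℓ ∷ r) → HalfOf n ℓ × DistinctOddBelow ℓ ℓ r
ρodShape⁻ {n} {ℓ} {r} ((1≤ℓ ∷ _ , nonincreasing , ℓ+Σr≡n) , once , odds , unique , Σr≡ℓ) =
  (1≤ℓ , trans (cong (_+_ ℓ) (trans (+-identityʳ ℓ) (sym Σr≡ℓ))) ℓ+Σr≡n) ,
  decreasing , odds , Σr≡ℓ
  where
  ℓ∉r : All (ℓ ≢_) r
  ℓ∉r = ¬Any⇒All¬ r (λ ℓ∈r → <⇒≢ (filter-some (ℓ ≟_) ℓ∈r)
                                  (sym (suc-injective (trans (sym (count-head ℓ r)) once))))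
  decreasing : Linked _>_ (ℓ ∷ r)
  decreasing = Linked.zipWith (λ (y≤x , x≢y) → ≤∧≢⇒< y≤x (x≢y ∘ sym))
                              (nonincreasing , AllPairs⇒Linked (ℓ∉r ∷ unique))

ρodShape⁺ : ∀ {n ℓ r} →
  HalfOf n ℓ × DistinctOddBelow ℓ ℓ r → IsPartition n (ℓ ∷ r) × ODCond (ℓ ∷ r)
ρodShape⁺ {n} {ℓ} {r} ((1≤ℓ , 2ℓ≡n) , decreasing , odds , Σr≡ℓ) =
  (1≤ℓ ∷ All.map odd⇒positive odds , Linked.map <⇒≤ decreasing ,
   trans (cong (_+_ ℓ) (trans Σr≡ℓ (sym (+-identityʳ ℓ)))) 2ℓ≡n) ,
  (trans (count-head ℓ r) (cong (suc ∘ length) (filter-none (ℓ ≟_) (All.map >⇒≢ below)))) ,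
  odds , AllPairs.map >⇒≢ (AllPairs.tail pairwise) , Σr≡ℓ
  where
  pairwise = Linked⇒AllPairs (λ x>y y>z → <-trans y>z x>y) decreasing
  below = AllPairs.head pairwise

ρod-as-sum : ∀ n → ρod n ≡ Σ<ℕ (suc n) (λ ℓ → when (halfOf? n ℓ) (distinctOdd ℓ ℓ))
ρod-as-sum n = begin
    ρod n
  ≡⟨ countWhere-concatMap ρod? (λ k → listsOf k (upTo (suc n))) id (suc n) ⟩
    countWhere ρod? [ [] ] + Σ<ℕ n (λ j → countWhere ρod? (listsOf (suc j) (upTo (suc n))))
  ≡⟨ cong₂ _+_ (trans (countWhere-[-] ρod? []) (when-no (ρod? []) proj₂))
              (Σ<ℕ-cong n (λ j _ → byLargestPart j)) ⟩
    Σ<ℕ n (λ j → Σ<ℕ (suc n) (λ ℓ → when (halfOf? n ℓ) (counted j ℓ)))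
  ≡⟨ Σ<ℕ-comm n (suc n) (λ j ℓ → when (halfOf? n ℓ) (counted j ℓ)) ⟩
    Σ<ℕ (suc n) (λ ℓ → Σ<ℕ n (λ j → when (halfOf? n ℓ) (counted j ℓ)))
  ≡⟨ Σ<ℕ-cong (suc n) (λ ℓ _ →
       trans (Σ<ℕ-when n (halfOf? n ℓ) (λ j → counted j ℓ)) (byHalf ℓ)) ⟩
    Σ<ℕ (suc n) (λ ℓ → when (halfOf? n ℓ) (distinctOdd ℓ ℓ))
  ∎
  where
  ρod? : Decidable (λ ps → IsPartition n ps × ODCond ps)
  ρod? ps = IsPartition? n ps ×-dec ODCond? ps
  counted : ℕ → ℕ → ℕ
  counted j ℓ = countWhere (distinctOddBelow? ℓ ℓ) (listsOf j (upTo (suc n)))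
  byLargestPart : ∀ j → countWhere ρod? (listsOf (suc j) (upTo (suc n))) ≡
                        Σ<ℕ (suc n) (λ ℓ → when (halfOf? n ℓ) (counted j ℓ))
  byLargestPart j =
    trans (countWhere-listsOf ρod? j (suc n))
          (Σ<ℕ-cong (suc n) (λ ℓ _ →
            trans (countWhere-≐ (ρod? ∘ (ℓ ∷_)) (λ r → halfOf? n ℓ ×-dec distinctOddBelow? ℓ ℓ r)
                                (ρodShape⁻ , ρodShape⁺) (listsOf j (upTo (suc n))))
                  (countWhere-const× (distinctOddBelow? ℓ ℓ) (halfOf? n ℓ)
                                     (listsOf j (upTo (suc n))))))
  byHalf : ∀ ℓ →
    when (halfOf? n ℓ) (Σ<ℕ n (λ j → counted j ℓ)) ≡ when (halfOf? n ℓ) (distinctOdd ℓ ℓ)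
  byHalf ℓ with halfOf? n ℓ
  ... | no  _    = refl
  ... | yes half =
    Σ-countWhere-distinctOddBelow n ℓ ℓ (m<n⇒m≤1+n (halfOf⇒< half)) (halfOf⇒< half)

ρod-double : ∀ t → ρod (2 * suc t) ≡ distinctOdd (suc t) (suc t)
ρod-double t =
  trans (ρod-as-sum n)
        (trans (Σ<ℕ-delta (suc n) {term} (suc t) (s≤s (m≤n*m (suc t) 2))
                 (λ ℓ _ ℓ≢1+t → when-no (halfOf? n ℓ)
                                  (λ (_ , 2ℓ≡n) → ℓ≢1+t (*-cancelˡ-≡ ℓ (suc t) 2 2ℓ≡n))))
               (when-yes (halfOf? n (suc t)) (s≤s z≤n , refl)))
  where
  n = 2 * suc t
  term : ℕ → ℕ
  term ℓ = when (halfOf? n ℓ) (distinctOdd ℓ ℓ)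

ρod-odd : ∀ s → ρod (suc (2 * s)) ≡ 0
ρod-odd s =
  trans (ρod-as-sum n)
        (Σ<ℕ-zero (suc n) {term}
                  (λ ℓ _ → when-no (halfOf? n ℓ) (λ (_ , 2ℓ≡n) → even≢odd ℓ s 2ℓ≡n)))
  where
  n = suc (2 * s)
  term : ℕ → ℕ
  term ℓ = when (halfOf? n ℓ) (distinctOdd ℓ ℓ)

distinctOdd-via-ρod : ∀ s →
  distinctOdd (suc s) s ≡ ρod (2 * s) + when (odd? s) 1 + when (s ≟ 0) 1
distinctOdd-via-ρod zero    = refl
distinctOdd-via-ρod (suc t) = begin
    distinctOdd s s + when (oddPart? s s) (distinctOdd s (s ∸ s))
  ≡⟨ cong₂ _+_ (sym (ρod-double t))
              (cong (when (oddPart? s s))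
                    (trans (cong (distinctOdd s) (n∸n≡0 s)) (distinctOdd-zero s))) ⟩
    ρod (2 * s) + when (oddPart? s s) 1
  ≡⟨ cong (_+_ (ρod (2 * s))) (when-⇔ (oddPart? s s) (odd? s) (mk⇔ proj₁ (_, ≤-refl))) ⟩
    ρod (2 * s) + when (odd? s) 1
  ≡⟨ sym (+-identityʳ _) ⟩
    ρod (2 * s) + when (odd? s) 1 + 0
  ∎
  where
  s = suc t

+-cancel : ∀ a b c → + (a + b + c) ℤ.- + b ℤ.- + c ≡ + a
+-cancel a b c = begin
    + (a + b + c) ℤ.- + b ℤ.- + c
  ≡⟨ cong (λ x → x ℤ.- + b ℤ.- + c) (trans (ℤ.pos-+ (a + b) c) (cong (ℤ._+ + c) (ℤ.pos-+ a b))) ⟩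
    + a ℤ.+ + b ℤ.+ + c ℤ.- + b ℤ.- + c
  ≡⟨ cancel (+ a) (+ b) (+ c) ⟩
    + a
  ∎
  where
  cancel : ∀ x y z → x ℤ.+ y ℤ.+ z ℤ.- y ℤ.- z ≡ x
  cancel = ℤ-Solver.solve-∀

ρod-even : ∀ s →
  + ρod (2 * s) ≡ + distinctOdd (suc s) s ℤ.- + when (odd? s) 1 ℤ.- + when (s ≟ 0) 1
ρod-even s =
  trans (sym (+-cancel (ρod (2 * s)) (when (odd? s) 1) (when (s ≟ 0) 1)))
        (cong (λ x → + x ℤ.- + when (odd? s) 1 ℤ.- + when (s ≟ 0) 1) (sym (distinctOdd-via-ρod s)))

-- Coefficients of the series

qˆ-diag : ∀ k → qˆ k k ≡ + 1
qˆ-diag k with k ≟ k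
... | yes _   = refl
... | no  k≢k = contradiction refl k≢k

qˆ-off : ∀ {k n} → k ≢ n → qˆ k n ≡ + 0
qˆ-off {k} {n} k≢n with k ≟ n
... | yes k≡n = contradiction k≡n k≢n
... | no  _   = refl

qˆ-respects : ∀ {a n b m} → a ≡ n ⇔ b ≡ m → qˆ a n ≡ qˆ b m
qˆ-respects {a} {n} {b} {m} a≡n⇔b≡m with a ≟ n | b ≟ m
... | yes _   | yes _   = refl
... | no  _   | no  _   = refl
... | yes a≡n | no  b≢m = contradiction (to a≡n⇔b≡m a≡n) b≢m
... | no  a≢n | yes b≡m = contradiction (from a≡n⇔b≡m b≡m) a≢n

qˆ-shift : ∀ a {c n} → c ≤ n → qˆ a (n ∸ c) ≡ qˆ (a + c) n
qˆ-shift a {c} c≤n =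
  qˆ-respects (mk⇔ (λ a≡n∸c → trans (cong (_+ c) a≡n∸c) (m∸n+n≡m c≤n))
                   (λ a+c≡n → trans (sym (m+n∸n≡m a c)) (cong (_∸ c) a+c≡n)))

one≗qˆ0 : ∀ n → one n ≡ qˆ 0 n
one≗qˆ0 zero    = refl
one≗qˆ0 (suc n) = refl

Σ<-cong : ∀ k {f g} → (∀ i → i < k → f i ≡ g i) → Σ< k f ≡ Σ< k g
Σ<-cong zero    f≗g = refl
Σ<-cong (suc k) f≗g =
  cong₂ ℤ._+_ (Σ<-cong k (λ i i<k → f≗g i (m<n⇒m<1+n i<k))) (f≗g k ≤-refl)

Σ<-zero : ∀ k {f} → (∀ i → i < k → f i ≡ + 0) → Σ< k f ≡ + 0
Σ<-zero zero    f≗0 = refl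
Σ<-zero (suc k) f≗0 =
  cong₂ ℤ._+_ (Σ<-zero k (λ i i<k → f≗0 i (m<n⇒m<1+n i<k))) (f≗0 k ≤-refl)

Σ<-delta : ∀ k {f} p → p < k → (∀ i → i < k → i ≢ p → f i ≡ + 0) → Σ< k f ≡ f p
Σ<-delta (suc k) {f} p p<1+k off with m<1+n⇒m<n∨m≡n p<1+k
... | inj₂ refl =
  trans (cong (ℤ._+ f k) (Σ<-zero k (λ i i<k → off i (m<n⇒m<1+n i<k) (<⇒≢ i<k))))
        (ℤ.+-identityˡ (f k))
... | inj₁ p<k  =
  trans (cong₂ ℤ._+_ (Σ<-delta k p p<k (λ i i<k → off i (m<n⇒m<1+n i<k)))
                     (off k ≤-refl (<⇒≢ p<k ∘ sym)))
        (ℤ.+-identityʳ (f p))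

Σ<-distrib-+ : ∀ k f g → Σ< k (λ i → f i ℤ.+ g i) ≡ Σ< k f ℤ.+ Σ< k g
Σ<-distrib-+ zero    f g = refl
Σ<-distrib-+ (suc k) f g =
  trans (cong (ℤ._+ (f k ℤ.+ g k)) (Σ<-distrib-+ k f g))
        (interchange ℤ.+-commutativeSemigroup (Σ< k f) (Σ< k g) (f k) (g k))

Σ<-neg : ∀ k f → Σ< k (λ i → - f i) ≡ - Σ< k f
Σ<-neg zero    f = refl
Σ<-neg (suc k) f =
  trans (cong (ℤ._+ - f k) (Σ<-neg k f)) (sym (ℤ.neg-distrib-+ (Σ< k f) (f k)))

⊛-congʳ : ∀ f {g h} → (∀ i → g i ≡ h i) → ∀ n → (f ⊛ g) n ≡ (f ⊛ h) n
⊛-congʳ f g≗h n = Σ<-cong (suc n) (λ i _ → cong (f i ℤ.*_) (g≗h (n ∸ i)))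

⊛-distribˡ-⊕ : ∀ f g h n → (f ⊛ (g ⊕ h)) n ≡ (f ⊛ g) n ℤ.+ (f ⊛ h) n
⊛-distribˡ-⊕ f g h n =
  trans (Σ<-cong (suc n) (λ i _ → ℤ.*-distribˡ-+ (f i) (g (n ∸ i)) (h (n ∸ i))))
        (Σ<-distrib-+ (suc n) (λ i → f i ℤ.* g (n ∸ i)) (λ i → f i ℤ.* h (n ∸ i)))

neg-⊛ : ∀ f g n → (neg f ⊛ g) n ≡ - (f ⊛ g) n
neg-⊛ f g n =
  trans (Σ<-cong (suc n) (λ i _ → sym (ℤ.neg-distribˡ-* (f i) (g (n ∸ i)))))
        (Σ<-neg (suc n) (λ i → f i ℤ.* g (n ∸ i)))

qˆ-⊛ : ∀ a g {n} → a ≤ n → (qˆ a ⊛ g) n ≡ g (n ∸ a)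
qˆ-⊛ a g {n} a≤n =
  trans (Σ<-delta (suc n) a (s≤s a≤n) off)
        (trans (cong (ℤ._* g (n ∸ a)) (qˆ-diag a)) (ℤ.*-identityˡ (g (n ∸ a))))
  where
  off : ∀ i → i < suc n → i ≢ a → qˆ a i ℤ.* g (n ∸ i) ≡ + 0
  off i _ i≢a = trans (cong (ℤ._* g (n ∸ i)) (qˆ-off (i≢a ∘ sym))) (ℤ.*-zeroˡ (g (n ∸ i)))

qˆ-⊛-< : ∀ a g {n} → n < a → (qˆ a ⊛ g) n ≡ + 0
qˆ-⊛-< a g {n} n<a = Σ<-zero (suc n) off
  where
  off : ∀ i → i < suc n → qˆ a i ℤ.* g (n ∸ i) ≡ + 0
  off i i<1+n =
    trans (cong (ℤ._* g (n ∸ i)) (qˆ-off (λ a≡i → <⇒≱ n<a (subst (_≤ n) (sym a≡i) (≤-pred i<1+n)))))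
          (ℤ.*-zeroˡ (g (n ∸ i)))

⊛-qˆ : ∀ f c {n} → c ≤ n → (f ⊛ qˆ c) n ≡ f (n ∸ c)
⊛-qˆ f c {n} c≤n =
  trans (Σ<-delta (suc n) (n ∸ c) (s≤s (m∸n≤m n c)) off)
        (trans (cong (λ k → f (n ∸ c) ℤ.* qˆ c k) (m∸[m∸n]≡n c≤n))
               (trans (cong (f (n ∸ c) ℤ.*_) (qˆ-diag c)) (ℤ.*-identityʳ (f (n ∸ c)))))
  where
  off : ∀ i → i < suc n → i ≢ n ∸ c → f i ℤ.* qˆ c (n ∸ i) ≡ + 0
  off i i<1+n i≢n∸c =
    trans (cong (f i ℤ.*_) (qˆ-off (λ c≡n∸i →
             i≢n∸c (trans (sym (m∸[m∸n]≡n (≤-pred i<1+n))) (cong (n ∸_) (sym c≡n∸i))))))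
          (ℤ.*-zeroʳ (f i))

⊛-qˆ-< : ∀ f c {n} → n < c → (f ⊛ qˆ c) n ≡ + 0
⊛-qˆ-< f c {n} n<c = Σ<-zero (suc n) off
  where
  off : ∀ i → i < suc n → f i ℤ.* qˆ c (n ∸ i) ≡ + 0
  off i _ =
    trans (cong (f i ℤ.*_) (qˆ-off (λ c≡n∸i → <⇒≱ n<c (subst (_≤ n) (sym c≡n∸i) (m∸n≤m n i)))))
          (ℤ.*-zeroʳ (f i))

⊛-one : ∀ f n → (f ⊛ one) n ≡ f n
⊛-one f n = trans (⊛-congʳ f one≗qˆ0 n) (⊛-qˆ f 0 z≤n)

qˆ-⊛-qˆ : ∀ a c n → (qˆ a ⊛ qˆ c) n ≡ qˆ (a + c) n
qˆ-⊛-qˆ a c n with a ≤? n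
... | yes a≤n =
  trans (qˆ-⊛ a (qˆ c) a≤n) (trans (qˆ-shift c a≤n) (cong (λ e → qˆ e n) (+-comm c a)))
... | no  a≰n =
  trans (qˆ-⊛-< a (qˆ c) (≰⇒> a≰n))
        (sym (qˆ-off (λ a+c≡n → a≰n (subst (a ≤_) a+c≡n (m≤m+n a c)))))

pow-qˆ : ∀ a k n → pow (qˆ a) k n ≡ qˆ (a * k) n
pow-qˆ a zero    n = trans (one≗qˆ0 n) (cong (λ e → qˆ e n) (sym (*-zeroʳ a)))
pow-qˆ a (suc k) n = begin
    (qˆ a ⊛ pow (qˆ a) k) n  ≡⟨ ⊛-congʳ (qˆ a) (pow-qˆ a k) n ⟩
    (qˆ a ⊛ qˆ (a * k)) n    ≡⟨ qˆ-⊛-qˆ a (a * k) n ⟩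
    qˆ (a + a * k) n         ≡⟨ cong (λ e → qˆ e n) (sym (*-suc a k)) ⟩
    qˆ (a * suc k) n         ∎

partialPoch : FPS → FPS → ℕ → FPS
partialPoch t s m = Π< m (λ k → one ⊖ t ⊛ pow s k)

pochFactor : ∀ a b k j → (one ⊖ neg (qˆ a) ⊛ pow (qˆ b) k) j ≡ (one ⊕ qˆ (a + b * k)) j
pochFactor a b k j = cong (ℤ._+_ (one j)) (begin
    - (neg (qˆ a) ⊛ pow (qˆ b) k) j  ≡⟨ cong -_ (neg-⊛ (qˆ a) (pow (qˆ b) k) j) ⟩
    - - (qˆ a ⊛ pow (qˆ b) k) j      ≡⟨ ℤ.neg-involutive _ ⟩
    (qˆ a ⊛ pow (qˆ b) k) j          ≡⟨ ⊛-congʳ (qˆ a) (pow-qˆ b k) j ⟩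
    (qˆ a ⊛ qˆ (b * k)) j            ≡⟨ qˆ-⊛-qˆ a (b * k) j ⟩
    qˆ (a + b * k) j                 ∎)

partialPoch-suc : ∀ a b m n → let P = partialPoch (neg (qˆ a)) (qˆ b) m in
  partialPoch (neg (qˆ a)) (qˆ b) (suc m) n ≡ P n ℤ.+ (P ⊛ qˆ (a + b * m)) n
partialPoch-suc a b m n = begin
    (P ⊛ (one ⊖ neg (qˆ a) ⊛ pow (qˆ b) m)) n  ≡⟨ ⊛-congʳ P (pochFactor a b m) n ⟩
    (P ⊛ (one ⊕ qˆ c)) n                       ≡⟨ ⊛-distribˡ-⊕ P one (qˆ c) n ⟩
    (P ⊛ one) n ℤ.+ (P ⊛ qˆ c) n               ≡⟨ cong (ℤ._+ (P ⊛ qˆ c) n) (⊛-one P n) ⟩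
    P n ℤ.+ (P ⊛ qˆ c) n                       ∎
  where
  P = partialPoch (neg (qˆ a)) (qˆ b) m
  c = a + b * m

oddPoch : ℕ → FPS
oddPoch = partialPoch (neg (qˆ 2)) (qˆ 4)

oddPoch-suc : ∀ m n → oddPoch (suc m) n ≡ oddPoch m n ℤ.+ (oddPoch m ⊛ qˆ (2 * suc (2 * m))) n
oddPoch-suc m n =
  trans (partialPoch-suc 2 4 m n)
        (cong (λ c → oddPoch m n ℤ.+ (oddPoch m ⊛ qˆ c) n) (2+4m≡2[1+2m] m))
  where
  2+4m≡2[1+2m] : ∀ x → 2 + 4 * x ≡ 2 * suc (2 * x)
  2+4m≡2[1+2m] = ℕ-Solver.solve-∀

oddPoch-even : ∀ m s → oddPoch m (2 * s) ≡ + distinctOdd (2 * m) s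
oddPoch-even zero    zero    = refl
oddPoch-even zero    (suc s) = refl
oddPoch-even (suc m) s = begin
    oddPoch (suc m) (2 * s)
  ≡⟨ oddPoch-suc m (2 * s) ⟩
    oddPoch m (2 * s) ℤ.+ (oddPoch m ⊛ qˆ (2 * k)) (2 * s)
  ≡⟨ cong₂ ℤ._+_ (oddPoch-even m s) newParts ⟩
    + distinctOdd (2 * m) s ℤ.+ + when (k ≤? s) (distinctOdd (2 * m) (s ∸ k))
  ≡⟨ sym (ℤ.pos-+ (distinctOdd (2 * m) s) (when (k ≤? s) (distinctOdd (2 * m) (s ∸ k)))) ⟩
    + (distinctOdd (2 * m) s + when (k ≤? s) (distinctOdd (2 * m) (s ∸ k)))
  ≡⟨ cong +_ (sym (distinctOdd-double-suc m s)) ⟩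
    + distinctOdd (2 * suc m) s
  ∎
  where
  k = suc (2 * m)
  newParts : (oddPoch m ⊛ qˆ (2 * k)) (2 * s) ≡ + when (k ≤? s) (distinctOdd (2 * m) (s ∸ k))
  newParts with k ≤? s
  ... | yes k≤s = begin
      (oddPoch m ⊛ qˆ (2 * k)) (2 * s)  ≡⟨ ⊛-qˆ (oddPoch m) (2 * k) (*-monoʳ-≤ 2 k≤s) ⟩
      oddPoch m (2 * s ∸ 2 * k)         ≡⟨ cong (oddPoch m) (sym (*-distribˡ-∸ 2 s k)) ⟩
      oddPoch m (2 * (s ∸ k))           ≡⟨ oddPoch-even m (s ∸ k) ⟩
      + distinctOdd (2 * m) (s ∸ k)     ∎
  ... | no  k≰s = ⊛-qˆ-< (oddPoch m) (2 * k) (*-monoʳ-< 2 (≰⇒> k≰s))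

oddPoch-odd : ∀ m s → oddPoch m (suc (2 * s)) ≡ + 0
oddPoch-odd zero    s = refl
oddPoch-odd (suc m) s =
  trans (oddPoch-suc m (suc (2 * s))) (cong₂ ℤ._+_ (oddPoch-odd m s) newParts)
  where
  k = suc (2 * m)
  newParts : (oddPoch m ⊛ qˆ (2 * k)) (suc (2 * s)) ≡ + 0
  newParts with k ≤? s
  ... | yes k≤s = begin
      (oddPoch m ⊛ qˆ (2 * k)) (suc (2 * s))  ≡⟨ ⊛-qˆ (oddPoch m) (2 * k) (m≤n⇒m≤1+n 2k≤2s) ⟩
      oddPoch m (suc (2 * s) ∸ 2 * k)         ≡⟨ cong (oddPoch m) (+-∸-assoc 1 2k≤2s) ⟩
      oddPoch m (suc (2 * s ∸ 2 * k))         ≡⟨ cong (oddPoch m ∘ suc) (sym (*-distribˡ-∸ 2 s k)) ⟩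
      oddPoch m (suc (2 * (s ∸ k)))           ≡⟨ oddPoch-odd m (s ∸ k) ⟩
      + 0                                     ∎
    where
    2k≤2s = *-monoʳ-≤ 2 k≤s
  ... | no  k≰s =
    ⊛-qˆ-< (oddPoch m) (2 * k) (subst (_≤ 2 * k) (*-suc 2 s) (*-monoʳ-≤ 2 (≰⇒> k≰s)))

pochInf-even : ∀ s → pochInf (neg (qˆ 2)) (qˆ 4) (2 * s) ≡ + distinctOdd (suc s) s
pochInf-even s =
  trans (oddPoch-even (suc (2 * s)) s)
        (cong +_ (distinctOdd-stable (<-≤-trans (s≤s (m≤n*m s 2)) (m≤n*m _ 2))))

pochInf-odd : ∀ s → pochInf (neg (qˆ 2)) (qˆ 4) (suc (2 * s)) ≡ + 0
pochInf-odd s = oddPoch-odd (suc (suc (2 * s))) s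

ΣS<-pointwise : ∀ k F n → ΣS< k F n ≡ Σ< k (λ j → F j n)
ΣS<-pointwise zero    F n = refl
ΣS<-pointwise (suc k) F n = cong (ℤ._+ F k n) (ΣS<-pointwise k F n)

inv1m-qˆ : ∀ d .{{_ : NonZero d}} n → inv1m (qˆ d) n ≡ + when (d ∣? n) 1
inv1m-qˆ d n = begin
    ΣS< (suc n) (pow (qˆ d)) n          ≡⟨ ΣS<-pointwise (suc n) (pow (qˆ d)) n ⟩
    Σ< (suc n) (λ j → pow (qˆ d) j n)   ≡⟨ Σ<-cong (suc n) (λ j _ → pow-qˆ d j n) ⟩
    Σ< (suc n) (λ j → qˆ (d * j) n)     ≡⟨ multiples ⟩
    + when (d ∣? n) 1                   ∎
  where
  multiples : Σ< (suc n) (λ j → qˆ (d * j) n) ≡ + when (d ∣? n) 1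
  multiples with d ∣? n
  ... | yes d∣n =
    trans (Σ<-delta (suc n) q (s≤s (subst (q ≤_) (sym n≡dq) (m≤n*m q d)))
                    (λ j _ j≢q → qˆ-off (λ dj≡n → j≢q (*-cancelˡ-≡ j q d (trans dj≡n n≡dq)))))
          (trans (cong (λ e → qˆ e n) (sym n≡dq)) (qˆ-diag n))
    where
    q = quotient d∣n
    n≡dq = m∣n⇒n≡m*quotient d∣n
  ... | no  d∤n =
    Σ<-zero (suc n) (λ j _ → qˆ-off (λ dj≡n → d∤n (subst (d ∣_) dj≡n (m∣m*n j))))

q²/[1-q⁴]-even : ∀ s → (qˆ 2 ⊛ inv1m (qˆ 4)) (2 * s) ≡ + when (odd? s) 1
q²/[1-q⁴]-even zero    = qˆ-⊛-< 2 (inv1m (qˆ 4)) (s≤s z≤n)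
q²/[1-q⁴]-even (suc t) = begin
    (qˆ 2 ⊛ inv1m (qˆ 4)) (2 * suc t)  ≡⟨ qˆ-⊛ 2 (inv1m (qˆ 4)) (m≤m*n 2 (suc t)) ⟩
    inv1m (qˆ 4) (2 * suc t ∸ 2)        ≡⟨ cong (λ e → inv1m (qˆ 4) (e ∸ 2)) (*-suc 2 t) ⟩
    inv1m (qˆ 4) (2 * t)                ≡⟨ inv1m-qˆ 4 (2 * t) ⟩
    + when (4 ∣? 2 * t) 1               ≡⟨ cong +_ (when-⇔ (4 ∣? 2 * t) (odd? (suc t)) 4∣2t⇔odd) ⟩
    + when (odd? (suc t)) 1             ∎
  where
  4∣2t⇔odd : 4 ∣ 2 * t ⇔ Odd (suc t)
  4∣2t⇔odd = ⇔.trans (mk⇔ (*-cancelˡ-∣ 2) (*-monoʳ-∣ 2)) (even⇔odd-suc t)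

q²/[1-q⁴]-odd : ∀ s → (qˆ 2 ⊛ inv1m (qˆ 4)) (suc (2 * s)) ≡ + 0
q²/[1-q⁴]-odd zero    = qˆ-⊛-< 2 (inv1m (qˆ 4)) (s≤s (s≤s z≤n))
q²/[1-q⁴]-odd (suc t) = begin
    (qˆ 2 ⊛ inv1m (qˆ 4)) (suc (2 * suc t))
  ≡⟨ qˆ-⊛ 2 (inv1m (qˆ 4)) (m≤n⇒m≤1+n (m≤m*n 2 (suc t))) ⟩
    inv1m (qˆ 4) (suc (2 * suc t) ∸ 2)
  ≡⟨ cong (λ e → inv1m (qˆ 4) (suc e ∸ 2)) (*-suc 2 t) ⟩
    inv1m (qˆ 4) (suc (2 * t))
  ≡⟨ inv1m-qˆ 4 (suc (2 * t)) ⟩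
    + when (4 ∣? suc (2 * t)) 1
  ≡⟨ cong +_ (when-no (4 ∣? suc (2 * t)) (odd-suc-double t ∘ ∣-trans (divides 2 refl))) ⟩
    + 0
  ∎

one-double : ∀ s → one (2 * s) ≡ + when (s ≟ 0) 1
one-double zero    = refl
one-double (suc s) = refl

theorem4 : (n : ℕ) →
    + ρod n ≡ (pochInf (neg (qˆ 2)) (qˆ 4) ⊖ qˆ 2 ⊛ inv1m (qˆ 4) ⊖ one) n
theorem4 n with parity n
... | even s =
  trans (ρod-even s)
        (sym (cong₂ ℤ._-_ (cong₂ ℤ._-_ (pochInf-even s) (q²/[1-q⁴]-even s)) (one-double s)))
... | odd s =
  trans (cong +_ (ρod-odd s))
        (sym (cong₂ (λ a b → a ℤ.- b ℤ.- + 0) (pochInf-odd s) (q²/[1-q⁴]-odd s)))
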